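{- Let $B$ be an $s$-extension of a finitely generated abelian group $A$ and let $C\subseteq B$ be a subgroup. If $\mathrm{Hom}_{A\cap C}(C,B)\subseteq\mathrm{Hom}_{A\cap C}(C,C)$, then $C$ is $A$-normal in $B$. Moreover, if $\mathrm{Hom}_{A\cap C}(C,B)\subseteq\mathrm{Hom}_{A\cap C}(C,C)$, then for every $A\subseteq A'\subseteq C\subseteq B'\subseteq B$ we have that $C$ is $A'$-normal in $B'$.
   Context: Fix a positive integer $s$. For a finitely generated abelian group $A$, an $s$-extension of $A$ is an abelian group $B$ containing $A$ such that $B/A$ is torsion and the torsion subgroup of $B$ is isomorphic to a subgroup of $(\mathbb{Q}/\mathbb{Z})^s$. For abelian groups $A\subseteq B,C$, $\mathrm{Hom}_A(B,C)$ denotes the set of homomorphisms $B\to C$ restricting to the identity on $A$, and $\mathrm{Aut}_A(B)$ the group of automorphisms of $B$ restricting to the identity on $A$. For abelian groups $A\subseteq B\subseteq M$, $B$ is called $A$-normal in $M$ if the restriction to $B$ of every element of $\mathrm{Aut}_A(M)$ maps $B$ to itself. If $B'\subseteq M$ is a subgroup not necessarily containing $A$, $B'$ is called $A$-normal in $M$ if $B'$ is $(A\cap B')$-normal in $A+B'$ and $A+B'$ is $A$-normal in $M$. -}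

module Defs where

open import Level using (Level; _⊔_)
open import Algebra.Bundles using (AbelianGroup)
open import Data.Nat using (ℕ; zero; suc)
open import Data.Integer using (ℤ; +_; -[1+_])
open import Data.Rational using (ℚ; _/_; _-_; _+_)
open import Data.Fin using (Fin)
open import Data.Product using (Σ; ∃; ∃₂; _×_)
open import Relation.Unary using (Pred; _∩_; _⊆_)
open import Relation.Binary.PropositionalEquality using (_≡_)

-- ℚ/ℤ : rationals modulo the integers (a setoid equality on ℚ)
_≈QZ_ : ℚ → ℚ → Set
q ≈QZ r = ∃ λ (z : ℤ) → (q - r) ≡ (z / 1)

module _ {c ℓ : Level} (G : AbelianGroup c ℓ) where
  open AbelianGroup G

  _·ℕ_ : ℕ → Carrier → Carrier
  zero ·ℕ x = ε
  suc n ·ℕ x = x ∙ (n ·ℕ x)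

  _·ℤ_ : ℤ → Carrier → Carrier
  (+ n) ·ℤ x = n ·ℕ x
  -[1+ n ] ·ℤ x = (suc n ·ℕ x) ⁻¹

  linComb : (n : ℕ) → (Fin n → ℤ) → (Fin n → Carrier) → Carrier
  linComb zero k g = ε
  linComb (suc n) k g = (k Fin.zero ·ℤ g Fin.zero) ∙ linComb n (λ i → k (Fin.suc i)) (λ i → g (Fin.suc i))
    where import Data.Fin as Fin

  record IsSubgroup {p : Level} (P : Pred Carrier p) : Set (c ⊔ ℓ ⊔ p) where
    field
      resp      : ∀ {x y} → x ≈ y → P x → P y
      has-ε     : P ε
      ∙-closed  : ∀ {x y} → P x → P y → P (x ∙ y)
      ⁻¹-closed : ∀ {x} → P x → P (x ⁻¹)

  _⊕_ : ∀ {p q} → Pred Carrier p → Pred Carrier q → Pred Carrier (c ⊔ ℓ ⊔ p ⊔ q)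
  (P ⊕ Q) x = ∃₂ λ a b → P a × Q b × (x ≈ (a ∙ b))

  FinitelyGenerated : ∀ {p} → Pred Carrier p → Set (c ⊔ ℓ ⊔ p)
  FinitelyGenerated P =
    Σ ℕ λ n → Σ (Fin n → Carrier) λ g →
      (∀ i → P (g i)) × (∀ {x} → P x → Σ (Fin n → ℤ) λ k → x ≈ linComb n k g)

  IsTorsion : Carrier → Set ℓ
  IsTorsion x = Σ ℕ λ n → (suc n ·ℕ x) ≈ ε

  -- G / P is torsion
  TorsionOver : ∀ {p} → Pred Carrier p → Set (c ⊔ p)
  TorsionOver P = ∀ x → Σ ℕ λ n → P (suc n ·ℕ x)

  -- an injective homomorphism from the torsion subgroup of G into (ℚ/ℤ)^s,
  -- i.e. an isomorphism of the torsion subgroup onto a subgroup of (ℚ/ℤ)^s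
  record TorsionEmbedding (s : ℕ) : Set (c ⊔ ℓ) where
    field
      φ    : (x : Carrier) → IsTorsion x → Fin s → ℚ
      cong : ∀ {x y} (p : IsTorsion x) (q : IsTorsion y) → x ≈ y → ∀ i → φ x p i ≈QZ φ y q i
      hom  : ∀ {x y} (p : IsTorsion x) (q : IsTorsion y) (r : IsTorsion (x ∙ y)) →
             ∀ i → φ (x ∙ y) r i ≈QZ (φ x p i + φ y q i)
      inj  : ∀ {x y} (p : IsTorsion x) (q : IsTorsion y) → (∀ i → φ x p i ≈QZ φ y q i) → x ≈ y

  -- G (the whole group) is an s-extension of its subgroup A
  record IsSExtension (s : ℕ) {p} (A : Pred Carrier p) : Set (c ⊔ ℓ ⊔ p) where
    field
      A-subgroup : IsSubgroup A
      A-fg       : FinitelyGenerated A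
      torsion    : TorsionOver A
      embed      : TorsionEmbedding s

  -- Hom_X(C, D): homomorphisms from the subgroup C to G with image in D,
  -- restricting to the identity on X
  record RelHom {x c' d} (X : Pred Carrier x) (C : Pred Carrier c') (D : Pred Carrier d)
         : Set (c ⊔ ℓ ⊔ x ⊔ c' ⊔ d) where
    field
      f    : (y : Carrier) → C y → Carrier
      into : ∀ y (p : C y) → D (f y p)
      cong : ∀ {y z} (p : C y) (q : C z) → y ≈ z → f y p ≈ f z q
      hom  : ∀ {y z} (p : C y) (q : C z) (r : C (y ∙ z)) → f (y ∙ z) r ≈ (f y p ∙ f z q)
      fix  : ∀ {y} (p : C y) → X y → f y p ≈ y

  record RelAut {x m} (X : Pred Carrier x) (M : Pred Carrier m) : Set (c ⊔ ℓ ⊔ x ⊔ m) where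
    field
      hom  : RelHom X M M
    open RelHom hom public
    field
      inj  : ∀ {y z} (p : M y) (q : M z) → f y p ≈ f z q → y ≈ z
      surj : ∀ {z} → M z → ∃₂ λ y (p : M y) → f y p ≈ z

  IsNormalIn : ∀ {x y m} → Pred Carrier x → Pred Carrier y → Pred Carrier m → Set (c ⊔ ℓ ⊔ x ⊔ y ⊔ m)
  IsNormalIn X Y M = (σ : RelAut X M) → ∀ z (p : M z) → Y z → Y (RelAut.f σ z p)

  -- for Y not necessarily containing A: Y is A-normal in M
  IsANormalIn : ∀ {a y m} → Pred Carrier a → Pred Carrier y → Pred Carrier m → Set (c ⊔ ℓ ⊔ a ⊔ y ⊔ m)
  IsANormalIn A Y M = IsNormalIn (A ∩ Y) Y (A ⊕ Y) × IsNormalIn A (A ⊕ Y) M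

module Submission where

open import Defs
open import Level using (Level)
open import Algebra.Bundles using (AbelianGroup)
open import Data.Nat using (ℕ)
open import Data.Product using (_×_; _,_)
open import Data.Unit using (tt)
open import Relation.Unary using (Pred; U; _∩_; _⊆_)

-- Every relative automorphism of an ambient group containing C restricts to an
-- element of Hom_{A∩C}(C, B); when all of these map C into C, every such
-- automorphism preserves C. On A ⊕ C an automorphism fixing A acts as the
-- identity on the first summand and preserves the second. The s-extension
-- hypothesis is only needed to know that A is a subgroup.

module _ {c ℓ : Level} (G : AbelianGroup c ℓ) where
  open AbelianGroup G

  RelAut⇒RelHom : ∀ {x m} {X : Pred Carrier x} {M : Pred Carrier m} →
    RelAut G X M → RelHom G X M M
  RelAut⇒RelHom record { hom = h } = h

  restrictRelHom : ∀ {x y m n c'} {X : Pred Carrier x} {Y : Pred Carrier y}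
    {M : Pred Carrier m} {N : Pred Carrier n} {C : Pred Carrier c'} →
    RelHom G X M N → C ⊆ M → (∀ {z} → C z → Y z → X z) → RelHom G Y C U
  restrictRelHom h C⊆M Y⊆X = record
    { f    = λ z q → f z (C⊆M q)
    ; into = λ _ _ → tt
    ; cong = λ q r → cong (C⊆M q) (C⊆M r)
    ; hom  = λ q r s → hom (C⊆M q) (C⊆M r) (C⊆M s)
    ; fix  = λ q y → fix (C⊆M q) (Y⊆X q y)
    }
    where open RelHom h

  module HomClosed {p : Level} {A C : Pred Carrier p}
    (A-subgroup : IsSubgroup G A) (C-subgroup : IsSubgroup G C)
    (closed : ∀ (h : RelHom G (A ∩ C) C U) z (q : C z) → C (RelHom.f h z q)) where
    open IsSubgroup C-subgroup using (resp)

    ⊆-⊕ʳ : C ⊆ _⊕_ G A C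
    ⊆-⊕ʳ {z} q = ε , z , IsSubgroup.has-ε A-subgroup , q , sym (identityˡ z)

    RelAut-preserves : ∀ {x m} {X : Pred Carrier x} {M : Pred Carrier m} →
      C ⊆ M → (∀ {z} → C z → A z → X z) → IsNormalIn G X C M
    RelAut-preserves C⊆M A⊆X σ z pz cz =
      resp (RelAut.cong σ (C⊆M cz) pz refl)
        (closed (restrictRelHom (RelAut⇒RelHom σ) C⊆M (λ q (a , _) → A⊆X q a)) z cz)

    ⊕-normal : IsNormalIn G A (_⊕_ G A C) U
    ⊕-normal σ z _ (a , b , pa , pb , z≈a∙b) =
      a , f b tt , pa , closed (restrictRelHom (RelAut⇒RelHom σ) _ (λ _ (a , _) → a)) b pb ,
      (begin
        f z tt          ≈⟨ cong tt tt z≈a∙b ⟩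
        f (a ∙ b) tt    ≈⟨ hom tt tt tt ⟩
        f a tt ∙ f b tt ≈⟨ ∙-congʳ (fix tt pa) ⟩
        a ∙ f b tt      ∎)
      where
      open RelHom (RelAut⇒RelHom σ) using (f; cong; hom; fix)
      open import Relation.Binary.Reasoning.Setoid setoid

proposition3p8 : ∀ {c ℓ p : Level} (s : ℕ) (B : AbelianGroup c ℓ)
    (A C : Pred (AbelianGroup.Carrier B) p) →
    IsSExtension B s A → IsSubgroup B C →
    (∀ (h : RelHom B (A ∩ C) C U) y (q : C y) → C (RelHom.f h y q)) →
    IsANormalIn B A C U ×
    (∀ (A' B' : Pred (AbelianGroup.Carrier B) p) → IsSubgroup B A' → IsSubgroup B B' →
      A ⊆ A' → A' ⊆ C → C ⊆ B' → IsNormalIn B A' C B')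
proposition3p8 s B A C ext C-subgroup closed =
  (RelAut-preserves ⊆-⊕ʳ (λ c a → a , c) , ⊕-normal) ,
  λ A' B' _ _ A⊆A' _ C⊆B' → RelAut-preserves C⊆B' (λ _ a → A⊆A' a)
  where open HomClosed B (IsSExtension.A-subgroup ext) C-subgroup closed
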